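{- For every nonzero $\alpha\in\mathbb{Z}[i]$, $N(\sigma(\alpha))\ge N(\alpha)$.
   Context: $N(a+bi)=a^2+b^2$. Positive Gaussian primes: $\mathbb{P}^+=\{a+bi: a>0,\ b\ge 0\}\cap\{\text{primes of }\mathbb{Z}[i]\}$. For nonzero $\alpha=\varepsilon\prod\pi_j^{e_j}$ with $\varepsilon$ a unit and distinct $\pi_j\in\mathbb{P}^+$, $\sigma(\alpha)=\prod\frac{\pi_j^{e_j+1}-1}{\pi_j-1}$. -}

module Defs where

open import Data.Integer using (ℤ; +_; _+_; _-_; _*_; -_; _<_; _≤_; 0ℤ; 1ℤ)
open import Data.Nat as ℕ using (ℕ; suc)
open import Data.Product using (Σ; _×_; _,_; proj₁; proj₂)
open import Data.Sum using (_⊎_)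
open import Data.List using (List; []; _∷_; map; foldr)
open import Data.List.Relation.Unary.All using (All)
open import Data.List.Relation.Unary.Unique.Propositional using (Unique)
open import Relation.Binary.PropositionalEquality using (_≡_; _≢_)
open import Relation.Nullary using (¬_)

record ℤ[i] : Set where
  constructor _+_i
  field
    re : ℤ
    im : ℤ
open ℤ[i] public

infixl 7 _*ᵍ_
infixl 6 _+ᵍ_

0ᵍ : ℤ[i]
0ᵍ = 0ℤ + 0ℤ i

1ᵍ : ℤ[i]
1ᵍ = 1ℤ + 0ℤ i

_+ᵍ_ : ℤ[i] → ℤ[i] → ℤ[i]
(a + b i) +ᵍ (c + d i) = (a + c) + (b + d) i

_*ᵍ_ : ℤ[i] → ℤ[i] → ℤ[i]
(a + b i) *ᵍ (c + d i) = (a * c - b * d) + (a * d + b * c) i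

_^ᵍ_ : ℤ[i] → ℕ → ℤ[i]
z ^ᵍ ℕ.zero = 1ᵍ
z ^ᵍ suc n = z *ᵍ (z ^ᵍ n)

N : ℤ[i] → ℤ
N (a + b i) = a * a + b * b

_∣ᵍ_ : ℤ[i] → ℤ[i] → Set
x ∣ᵍ y = Σ ℤ[i] λ q → y ≡ x *ᵍ q

IsUnit : ℤ[i] → Set
IsUnit u = Σ ℤ[i] λ v → u *ᵍ v ≡ 1ᵍ

IsPrime : ℤ[i] → Set
IsPrime p = (p ≢ 0ᵍ) × (¬ IsUnit p) × (∀ x y → p ∣ᵍ (x *ᵍ y) → (p ∣ᵍ x) ⊎ (p ∣ᵍ y))

IsPositivePrime : ℤ[i] → Set
IsPositivePrime p = (0ℤ < re p) × (0ℤ ≤ im p) × IsPrime p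

geomSum : ℤ[i] → ℕ → ℤ[i]
geomSum p ℕ.zero = 1ᵍ
geomSum p (suc e) = 1ᵍ +ᵍ p *ᵍ geomSum p e

prodᵍ : List ℤ[i] → ℤ[i]
prodᵍ = foldr _*ᵍ_ 1ᵍ

record Factorization (α : ℤ[i]) : Set where
  field
    unit      : ℤ[i]
    unitIsUnit : IsUnit unit
    factors   : List (ℤ[i] × ℕ)
    primes    : All (λ pe → IsPositivePrime (proj₁ pe)) factors
    expPos    : All (λ pe → 1 ℕ.≤ proj₂ pe) factors
    distinct  : Unique (map proj₁ factors)
    equation  : α ≡ unit *ᵍ prodᵍ (map (λ pe → proj₁ pe ^ᵍ proj₂ pe) factors)

σ : ∀ {α} → Factorization α → ℤ[i]
σ F = prodᵍ (map (λ pe → geomSum (proj₁ pe) (proj₂ pe)) (Factorization.factors F))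

-- Both N and σ are multiplicative and units have norm 1, so it suffices to show
-- N(π^e) ≤ N(1 + π + ⋯ + π^e) for a single non-unit π with re π > 0 (so N π > 1).
-- For e = 1 this is N(1 + π) = N π + 2 re π + 1. For e ≥ 2 put n = N π, m = N(π^e),
-- z = π^(e+1) and g = N(1 + π + ⋯ + π^e); then n < m. Telescoping gives
-- N(π − 1) g = N(z − 1) = nm − 2 re z + 1, and (2 re z)² ≤ 4 N z = 4nm < (n + m)² gives
-- 2 re z < n + m. As N(π − 1) = n − 2 re π + 1 ≤ n − 1, this yields
-- N(π − 1)(m − 1) ≤ (n − 1)(m − 1) < N(π − 1) g, hence g ≥ m.
module Submission where

open import Defs
open import Data.Integer using (_≤_)
open import Relation.Binary.PropositionalEquality using (_≢_)

open import Data.Integer using (ℤ; +_; _+_; _-_; _*_; -_; _<_; 0ℤ; 1ℤ; +≤+)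
open import Data.Integer.Properties using (nonNegative⁻¹; ≤-refl; ≤-trans; ≤-<-trans; <-trans; ≤-total; <⇒≤; <-irrefl; _<?_; ≮⇒≥; ≤∧≢⇒<; i≤i+j; i-j≤i; i≤j⇒0≤j-i; i<j⇒suc[i]≤j; suc[i]≤j⇒i<j; +-monoʳ-≤; +-monoˡ-≤; +-monoʳ-<; +-monoˡ-<; +-mono-≤; neg-mono-<; *-zeroʳ; *-identityˡ; *-identityʳ; *-monoˡ-≤-nonNeg; *-monoʳ-≤-nonNeg; *-monoˡ-≤-nonPos; *-monoˡ-<-pos; *-cancelˡ-<-nonNeg; pos-*; +-injective; module ≤-Reasoning)
open import Data.Integer.Base using (nonNegative; nonPositive; positive)
open import Data.Integer.Tactic.RingSolver using (solve; solve-∀)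
open import Data.Nat using (zero; suc)
open import Data.Nat.Properties using (m*n≡1⇒m≡1)
open import Data.Product using (_,_; proj₁; proj₂)
open import Data.Sum using (inj₁; inj₂)
open import Data.Empty using (⊥-elim)
open import Data.List using (List; []; _∷_; map)
open import Data.List.Relation.Unary.All as All using (All)
open import Function using (_∋_)
open import Relation.Nullary using (¬_; yes; no)
open import Relation.Binary.PropositionalEquality using (_≡_; refl; sym; trans; cong; cong₂; subst; module ≡-Reasoning)

*-nonNeg : ∀ {x y} → 0ℤ ≤ x → 0ℤ ≤ y → 0ℤ ≤ x * y
*-nonNeg {x} {y} 0≤x 0≤y = subst (_≤ x * y) (*-zeroʳ x) (*-monoˡ-≤-nonNeg x {{nonNegative 0≤x}} 0≤y)

square-nonNeg : ∀ x → 0ℤ ≤ x * x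
square-nonNeg x with ≤-total 0ℤ x
... | inj₁ 0≤x = *-nonNeg 0≤x 0≤x
... | inj₂ x≤0 = subst (_≤ x * x) (*-zeroʳ x) (*-monoˡ-≤-nonPos x {{nonPositive x≤0}} x≤0)

*-mono-≤-nonNeg : ∀ {x y u v} → 0ℤ ≤ x → 0ℤ ≤ y → x ≤ u → y ≤ v → x * y ≤ u * v
*-mono-≤-nonNeg {x} {y} {u} {v} 0≤x 0≤y x≤u y≤v =
  ≤-trans (*-monoˡ-≤-nonNeg x {{nonNegative 0≤x}} y≤v)
          (*-monoʳ-≤-nonNeg v {{nonNegative (≤-trans 0≤y y≤v)}} x≤u)

nonNeg-*≡1⇒≡1 : ∀ {x y} → 0ℤ ≤ x → 0ℤ ≤ y → x * y ≡ 1ℤ → x ≡ 1ℤ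
nonNeg-*≡1⇒≡1 {+ m} {+ n} (+≤+ _) (+≤+ _) xy≡1 =
  cong +_ (m*n≡1⇒m≡1 m n (+-injective (trans (pos-* m n) xy≡1)))

strict-AM-GM : ∀ {n m} → n < m → + 4 * (n * m) < (n + m) * (n + m)
strict-AM-GM {n} {m} n<m = suc[i]≤j⇒i<j (begin
  1ℤ + + 4 * (n * m)                  ≡⟨ solve (n ∷ m ∷ []) ⟩
  + 4 * (n * m) + 1ℤ * 1ℤ             ≤⟨ +-monoʳ-≤ (+ 4 * (n * m)) (*-mono-≤-nonNeg (nonNegative⁻¹ 1ℤ) (nonNegative⁻¹ 1ℤ) 1≤m-n 1≤m-n) ⟩
  + 4 * (n * m) + (m - n) * (m - n)   ≡⟨ solve (n ∷ m ∷ []) ⟩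
  (n + m) * (n + m)                   ∎)
  where
  open ≤-Reasoning
  1≤m-n : 1ℤ ≤ m - n
  1≤m-n = begin
    1ℤ              ≡⟨ solve (n ∷ []) ⟩
    1ℤ + n - n      ≤⟨ +-monoˡ-≤ (- n) (i<j⇒suc[i]≤j n<m) ⟩
    m - n           ∎

x²+y²≡nm⇒2x<n+m : ∀ {x y n m} → x * x + y * y ≡ n * m → 0ℤ ≤ n → n < m → + 2 * x < n + m
x²+y²≡nm⇒2x<n+m {x} {y} {n} {m} x²+y²≡nm 0≤n n<m with + 2 * x <? n + m
... | yes 2x<n+m = 2x<n+m
... | no 2x≮n+m = ⊥-elim (<-irrefl refl (begin-strict
  (n + m) * (n + m)       ≤⟨ *-mono-≤-nonNeg 0≤n+m 0≤n+m n+m≤2x n+m≤2x ⟩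
  (+ 2 * x) * (+ 2 * x)   ≡⟨ solve (x ∷ []) ⟩
  + 4 * (x * x)           ≤⟨ *-monoˡ-≤-nonNeg (+ 4) (i≤i+j (x * x) (y * y) {{nonNegative (square-nonNeg y)}}) ⟩
  + 4 * (x * x + y * y)   ≡⟨ cong (+ 4 *_) x²+y²≡nm ⟩
  + 4 * (n * m)           <⟨ strict-AM-GM n<m ⟩
  (n + m) * (n + m)       ∎))
  where
  open ≤-Reasoning
  n+m≤2x : n + m ≤ + 2 * x
  n+m≤2x = ≮⇒≥ 2x≮n+m
  0≤n+m : 0ℤ ≤ n + m
  0≤n+m = +-mono-≤ 0≤n (≤-trans 0≤n (<⇒≤ n<m))

pg≡nm-2x+1⇒m≤g : ∀ {n m p g x} → 0ℤ ≤ p → p ≤ n - 1ℤ → 1ℤ ≤ m → + 2 * x < n + m →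
                 p * g ≡ n * m - + 2 * x + 1ℤ → m ≤ g
pg≡nm-2x+1⇒m≤g {n} {m} {p} {g} {x} 0≤p p≤n-1 1≤m 2x<n+m pg≡nm-2x+1 = begin
  m               ≡⟨ solve (m ∷ []) ⟩
  1ℤ + (m - 1ℤ)   ≤⟨ i<j⇒suc[i]≤j (*-cancelˡ-<-nonNeg p {{nonNegative 0≤p}} p[m-1]<pg) ⟩
  g               ∎
  where
  open ≤-Reasoning
  p[m-1]<pg : p * (m - 1ℤ) < p * g
  p[m-1]<pg = begin-strict
    p * (m - 1ℤ)          ≤⟨ *-monoʳ-≤-nonNeg (m - 1ℤ) {{nonNegative (i≤j⇒0≤j-i 1≤m)}} p≤n-1 ⟩
    (n - 1ℤ) * (m - 1ℤ)   ≡⟨ solve (n ∷ m ∷ []) ⟩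
    n * m - (n + m) + 1ℤ  <⟨ +-monoˡ-< 1ℤ (+-monoʳ-< (n * m) (neg-mono-< 2x<n+m)) ⟩
    n * m - + 2 * x + 1ℤ  ≡⟨ pg≡nm-2x+1 ⟨
    p * g                 ∎

N-nonNeg : ∀ z → 0ℤ ≤ N z
N-nonNeg (a + b i) = +-mono-≤ (square-nonNeg a) (square-nonNeg b)

brahmagupta-fibonacci : ∀ a b c d →
  (a * c - b * d) * (a * c - b * d) + (a * d + b * c) * (a * d + b * c) ≡ (a * a + b * b) * (c * c + d * d)
brahmagupta-fibonacci = solve-∀

N-*ᵍ : ∀ z w → N (z *ᵍ w) ≡ N z * N w
N-*ᵍ (a + b i) (c + d i) = brahmagupta-fibonacci a b c d

*ᵍ-identityʳ : ∀ z → z *ᵍ 1ᵍ ≡ z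
*ᵍ-identityʳ (a + b i) = cong₂ _+_i (a * 1ℤ - b * 0ℤ ≡ a ∋ solve (a ∷ b ∷ []))
                                   (a * 0ℤ + b * 1ℤ ≡ b ∋ solve (a ∷ b ∷ []))

conj : ℤ[i] → ℤ[i]
conj (a + b i) = a + (- b) i

*ᵍ-conj : ∀ z → z *ᵍ conj z ≡ N z + 0ℤ i
*ᵍ-conj (a + b i) = cong₂ _+_i (a * a - b * - b ≡ a * a + b * b ∋ solve (a ∷ b ∷ []))
                              (a * - b + b * a ≡ 0ℤ ∋ solve (a ∷ b ∷ []))

N≡1⇒IsUnit : ∀ {z} → N z ≡ 1ℤ → IsUnit z
N≡1⇒IsUnit {z} Nz≡1 = conj z , trans (*ᵍ-conj z) (cong (λ n → n + 0ℤ i) Nz≡1)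

IsUnit⇒N≡1 : ∀ {u} → IsUnit u → N u ≡ 1ℤ
IsUnit⇒N≡1 {u} (v , uv≡1) =
  nonNeg-*≡1⇒≡1 (N-nonNeg u) (N-nonNeg v) (trans (sym (N-*ᵍ u v)) (cong N uv≡1))

N-unit-*ᵍ : ∀ {u} → IsUnit u → ∀ z → N (u *ᵍ z) ≡ N z
N-unit-*ᵍ {u} u-unit z = begin
  N (u *ᵍ z)   ≡⟨ N-*ᵍ u z ⟩
  N u * N z    ≡⟨ cong (_* N z) (IsUnit⇒N≡1 {u} u-unit) ⟩
  1ℤ * N z     ≡⟨ *-identityˡ (N z) ⟩
  N z          ∎
  where open ≡-Reasoning

1≤N : ∀ {z} → 0ℤ < re z → 1ℤ ≤ N z
1≤N {a + b i} 0<a =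
  ≤-trans (*-mono-≤-nonNeg (nonNegative⁻¹ 1ℤ) (nonNegative⁻¹ 1ℤ) 1≤a 1≤a) (i≤i+j (a * a) (b * b) {{nonNegative (square-nonNeg b)}})
  where
  1≤a : 1ℤ ≤ a
  1≤a = i<j⇒suc[i]≤j 0<a

1<N : ∀ {z} → 0ℤ < re z → ¬ IsUnit z → 1ℤ < N z
1<N {z} 0<re ¬unit = ≤∧≢⇒< (1≤N {z} 0<re) (λ 1≡N → ¬unit (N≡1⇒IsUnit {z} (sym 1≡N)))

1≤N-^ᵍ : ∀ {z} → 1ℤ ≤ N z → ∀ k → 1ℤ ≤ N (z ^ᵍ k)
1≤N-^ᵍ _ zero = ≤-refl
1≤N-^ᵍ {z} 1≤Nz (suc k) = subst (1ℤ ≤_) (sym (N-*ᵍ z (z ^ᵍ k)))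
  (*-mono-≤-nonNeg (nonNegative⁻¹ 1ℤ) (nonNegative⁻¹ 1ℤ) 1≤Nz (1≤N-^ᵍ {z} 1≤Nz k))

N≤N-*ᵍ : ∀ z {w} → 1ℤ ≤ N w → N z ≤ N (z *ᵍ w)
N≤N-*ᵍ z {w} 1≤Nw = begin
  N z          ≡⟨ *-identityʳ (N z) ⟨
  N z * 1ℤ     ≤⟨ *-monoˡ-≤-nonNeg (N z) {{nonNegative (N-nonNeg z)}} 1≤Nw ⟩
  N z * N w    ≡⟨ N-*ᵍ z w ⟨
  N (z *ᵍ w)   ∎
  where open ≤-Reasoning

N<N-^ᵍ : ∀ {z} → 1ℤ < N z → ∀ k → N z < N (z ^ᵍ suc (suc k))
N<N-^ᵍ {z} 1<Nz k = begin-strict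
  N z                    ≡⟨ *-identityʳ (N z) ⟨
  N z * 1ℤ               <⟨ *-monoˡ-<-pos (N z) {{positive 0<Nz}} 1<Nz ⟩
  N z * N z              ≤⟨ *-monoˡ-≤-nonNeg (N z) {{nonNegative (N-nonNeg z)}} (N≤N-*ᵍ z (1≤N-^ᵍ {z} (<⇒≤ 1<Nz) k)) ⟩
  N z * N (z ^ᵍ suc k)   ≡⟨ N-*ᵍ z (z ^ᵍ suc k) ⟨
  N (z ^ᵍ suc (suc k))   ∎
  where
  open ≤-Reasoning
  0<Nz : 0ℤ < N z
  0<Nz = ≤-<-trans (nonNegative⁻¹ 1ℤ) 1<Nz

N≤N-1ᵍ+ᵍ : ∀ {z} → 0ℤ ≤ re z → N z ≤ N (1ᵍ +ᵍ z)
N≤N-1ᵍ+ᵍ {a + b i} 0≤a = begin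
  a * a + b * b                                ≤⟨ i≤i+j (a * a + b * b) (+ 2 * a + 1ℤ) {{nonNegative 0≤2a+1}} ⟩
  a * a + b * b + (+ 2 * a + 1ℤ)               ≡⟨ solve (a ∷ b ∷ []) ⟩
  (1ℤ + a) * (1ℤ + a) + (0ℤ + b) * (0ℤ + b)    ∎
  where
  open ≤-Reasoning
  0≤2a+1 : 0ℤ ≤ + 2 * a + 1ℤ
  0≤2a+1 = +-mono-≤ (*-nonNeg (nonNegative⁻¹ (+ 2)) 0≤a) (nonNegative⁻¹ 1ℤ)

predᵍ : ℤ[i] → ℤ[i]
predᵍ z = (re z - 1ℤ) + im z i

1ᵍ+ᵍpredᵍ : ∀ z → 1ᵍ +ᵍ predᵍ z ≡ z
1ᵍ+ᵍpredᵍ (a + b i) = cong₂ _+_i (1ℤ + (a - 1ℤ) ≡ a ∋ solve (a ∷ []))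
                                (0ℤ + b ≡ b ∋ solve (b ∷ []))

N-predᵍ : ∀ z → N (predᵍ z) ≡ N z - + 2 * re z + 1ℤ
N-predᵍ (a + b i) = (a - 1ℤ) * (a - 1ℤ) + b * b ≡ a * a + b * b - + 2 * a + 1ℤ ∋ solve (a ∷ b ∷ [])

N-predᵍ≤N-1 : ∀ {z} → 0ℤ < re z → N (predᵍ z) ≤ N z - 1ℤ
N-predᵍ≤N-1 {a + b i} 0<a = begin
  (a - 1ℤ) * (a - 1ℤ) + b * b                 ≡⟨ solve (a ∷ b ∷ []) ⟩
  a * a + b * b - 1ℤ - + 2 * (a - 1ℤ)         ≤⟨ i-j≤i (a * a + b * b - 1ℤ) (+ 2 * (a - 1ℤ)) {{nonNegative 0≤2[a-1]}} ⟩
  a * a + b * b - 1ℤ                          ∎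
  where
  open ≤-Reasoning
  0≤2[a-1] : 0ℤ ≤ + 2 * (a - 1ℤ)
  0≤2[a-1] = *-nonNeg (nonNegative⁻¹ (+ 2)) (i≤j⇒0≤j-i (i<j⇒suc[i]≤j 0<a))

predᵍ-*ᵍ-1ᵍ+ᵍ : ∀ z w → predᵍ z *ᵍ (1ᵍ +ᵍ z *ᵍ w) ≡ predᵍ (z *ᵍ (1ᵍ +ᵍ predᵍ z *ᵍ w))
predᵍ-*ᵍ-1ᵍ+ᵍ (a + b i) (c + d i) = cong₂ _+_i
  ((a - 1ℤ) * (1ℤ + (a * c - b * d)) - b * (0ℤ + (a * d + b * c))
     ≡ a * (1ℤ + ((a - 1ℤ) * c - b * d)) - b * (0ℤ + ((a - 1ℤ) * d + b * c)) - 1ℤ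
   ∋ solve (a ∷ b ∷ c ∷ d ∷ []))
  ((a - 1ℤ) * (0ℤ + (a * d + b * c)) + b * (1ℤ + (a * c - b * d))
     ≡ a * (0ℤ + ((a - 1ℤ) * d + b * c)) + b * (1ℤ + ((a - 1ℤ) * c - b * d))
   ∋ solve (a ∷ b ∷ c ∷ d ∷ []))

predᵍ-*ᵍ-geomSum : ∀ z e → predᵍ z *ᵍ geomSum z e ≡ predᵍ (z ^ᵍ suc e)
predᵍ-*ᵍ-geomSum z zero = trans (*ᵍ-identityʳ (predᵍ z)) (cong predᵍ (sym (*ᵍ-identityʳ z)))
predᵍ-*ᵍ-geomSum z (suc e) = begin
  predᵍ z *ᵍ (1ᵍ +ᵍ z *ᵍ geomSum z e)                 ≡⟨ predᵍ-*ᵍ-1ᵍ+ᵍ z (geomSum z e) ⟩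
  predᵍ (z *ᵍ (1ᵍ +ᵍ predᵍ z *ᵍ geomSum z e))         ≡⟨ cong (λ w → predᵍ (z *ᵍ (1ᵍ +ᵍ w))) (predᵍ-*ᵍ-geomSum z e) ⟩
  predᵍ (z *ᵍ (1ᵍ +ᵍ predᵍ (z ^ᵍ suc e)))             ≡⟨ cong (λ w → predᵍ (z *ᵍ w)) (1ᵍ+ᵍpredᵍ (z ^ᵍ suc e)) ⟩
  predᵍ (z ^ᵍ suc (suc e))                             ∎
  where open ≡-Reasoning

N-^ᵍ≤N-geomSum : ∀ {z} → 0ℤ < re z → 1ℤ < N z → ∀ e → N (z ^ᵍ e) ≤ N (geomSum z e)
N-^ᵍ≤N-geomSum _ _ zero = ≤-refl
N-^ᵍ≤N-geomSum {z} 0<re _ (suc zero) =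
  subst (λ w → N w ≤ N (1ᵍ +ᵍ w)) (sym (*ᵍ-identityʳ z)) (N≤N-1ᵍ+ᵍ {z} (<⇒≤ 0<re))
N-^ᵍ≤N-geomSum {z} 0<re 1<Nz e@(suc (suc k)) =
  pg≡nm-2x+1⇒m≤g {n = N z} (N-nonNeg (predᵍ z)) (N-predᵍ≤N-1 {z} 0<re) 1≤Nz^e 2re<n+m pg≡nm-2re+1
  where
  n<m : N z < N (z ^ᵍ e)
  n<m = N<N-^ᵍ {z} 1<Nz k
  1≤Nz^e : 1ℤ ≤ N (z ^ᵍ e)
  1≤Nz^e = <⇒≤ (<-trans 1<Nz n<m)
  2re<n+m : + 2 * re (z ^ᵍ suc e) < N z + N (z ^ᵍ e)
  2re<n+m = x²+y²≡nm⇒2x<n+m {re (z ^ᵍ suc e)} {im (z ^ᵍ suc e)} (N-*ᵍ z (z ^ᵍ e)) (N-nonNeg z) n<m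
  pg≡nm-2re+1 : N (predᵍ z) * N (geomSum z e) ≡ N z * N (z ^ᵍ e) - + 2 * re (z ^ᵍ suc e) + 1ℤ
  pg≡nm-2re+1 = begin
    N (predᵍ z) * N (geomSum z e)                  ≡⟨ N-*ᵍ (predᵍ z) (geomSum z e) ⟨
    N (predᵍ z *ᵍ geomSum z e)                     ≡⟨ cong N (predᵍ-*ᵍ-geomSum z e) ⟩
    N (predᵍ (z ^ᵍ suc e))                         ≡⟨ N-predᵍ (z ^ᵍ suc e) ⟩
    N (z ^ᵍ suc e) - + 2 * re (z ^ᵍ suc e) + 1ℤ    ≡⟨ cong (λ t → t - + 2 * re (z ^ᵍ suc e) + 1ℤ) (N-*ᵍ z (z ^ᵍ e)) ⟩
    N z * N (z ^ᵍ e) - + 2 * re (z ^ᵍ suc e) + 1ℤ  ∎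
    where open ≡-Reasoning

N-prodᵍ-mono : ∀ {A : Set} (f g : A → ℤ[i]) {xs : List A} → All (λ x → N (f x) ≤ N (g x)) xs →
               N (prodᵍ (map f xs)) ≤ N (prodᵍ (map g xs))
N-prodᵍ-mono f g All.[] = ≤-refl
N-prodᵍ-mono f g {x ∷ xs} (fx≤gx All.∷ fxs≤gxs) = begin
  N (f x *ᵍ prodᵍ (map f xs))       ≡⟨ N-*ᵍ (f x) (prodᵍ (map f xs)) ⟩
  N (f x) * N (prodᵍ (map f xs))    ≤⟨ *-mono-≤-nonNeg (N-nonNeg (f x)) (N-nonNeg (prodᵍ (map f xs))) fx≤gx (N-prodᵍ-mono f g fxs≤gxs) ⟩
  N (g x) * N (prodᵍ (map g xs))    ≡⟨ N-*ᵍ (g x) (prodᵍ (map g xs)) ⟨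
  N (g x *ᵍ prodᵍ (map g xs))       ∎
  where open ≤-Reasoning

mainTheorem4 : (α : ℤ[i]) → α ≢ 0ᵍ → (F : Factorization α) → N α ≤ N (σ F)
mainTheorem4 α _ F = begin
  N α               ≡⟨ cong N equation ⟩
  N (unit *ᵍ ∏π^e)  ≡⟨ N-unit-*ᵍ {unit} unitIsUnit ∏π^e ⟩
  N ∏π^e            ≤⟨ N-prodᵍ-mono (λ pe → proj₁ pe ^ᵍ proj₂ pe) (λ pe → geomSum (proj₁ pe) (proj₂ pe))
                             (All.map (λ {pe} → factor-bound {pe}) primes) ⟩
  N (σ F)           ∎
  where
  open Factorization F
  open ≤-Reasoning
  ∏π^e : ℤ[i]
  ∏π^e = prodᵍ (map (λ pe → proj₁ pe ^ᵍ proj₂ pe) factors)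
  factor-bound : ∀ {pe} → IsPositivePrime (proj₁ pe) → N (proj₁ pe ^ᵍ proj₂ pe) ≤ N (geomSum (proj₁ pe) (proj₂ pe))
  factor-bound {π , e} (0<re , _ , _ , ¬unit , _) = N-^ᵍ≤N-geomSum {π} 0<re (1<N {π} 0<re ¬unit) e
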